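{- Let $\vdash$ be a regular entailment relation for a commutative preordered group $G$ and let $x\in G$. Define $A\vdash_x B$ to hold iff there exists an integer $p\geqslant 0$ such that $A,A+px\vdash B$. Then $\vdash_x$ is a regular entailment relation, and it is the least regular entailment relation containing $\vdash$ and such that $0\vdash_x x$.
   Context: A commutative preordered group is an abelian group $G$ with a preorder $\leqslant$ such that $a\leqslant b$ implies $a+c\leqslant b+c$. $A,B,A',B'$ denote nonempty finite subsets of $G$; $a$ stands for $\{a\}$, $A,B$ for $A\cup B$, $A+y=\{a+y:a\in A\}$, and $px$ is the $p$-fold multiple. A regular entailment relation for $G$ is a relation $A\vdash B$ between nonempty finite subsets such that: (R1) $A\vdash B$ if $A\supseteq A'$, $B\supseteq B'$ and $A'\vdash B'$; (R2) $A\vdash B$ if $A,y\vdash B$ and $A\vdash B,y$; (R3) $a\vdash b$ if $a\leqslant b$; (R4) $A\vdash B$ if $A+y\vdash B+y$; (R5) $a+u,b+v\vdash a+b,u+v$ for all $a,b,u,v\in G$. A relation contains $\vdash$ if it holds whenever $\vdash$ does. -}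

module Defs where

open import Level using (Level; _⊔_; suc)
open import Data.Nat using (ℕ; zero; suc)
open import Data.Product using (Σ; ∃; _×_; _,_)
open import Data.List.NonEmpty using (List⁺; [_]; _⁺++⁺_; toList)
import Data.List.NonEmpty as L⁺
open import Algebra.Bundles using (AbelianGroup)
open import Relation.Binary.Structures using (IsPreorder)
import Data.List.Relation.Binary.Subset.Setoid as Subset

record PreorderedAbelianGroup (c ℓ₁ ℓ₂ : Level) : Set (Level.suc (c ⊔ ℓ₁ ⊔ ℓ₂)) where
  field
    abelianGroup : AbelianGroup c ℓ₁
  open AbelianGroup abelianGroup public
  field
    _≤_        : Carrier → Carrier → Set ℓ₂
    isPreorder : IsPreorder _≈_ _≤_
    ≤-compat   : ∀ {a b} c → a ≤ b → (a ∙ c) ≤ (b ∙ c)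

module Entailment {c ℓ₁ ℓ₂ : Level} (P : PreorderedAbelianGroup c ℓ₁ ℓ₂) where
  open PreorderedAbelianGroup P
  open Subset setoid using (_⊆_)

  -- nonempty finite subsets of G, represented by nonempty lists
  FinSub : Set c
  FinSub = List⁺ Carrier

  _⊇ˢ_ : FinSub → FinSub → Set (c ⊔ ℓ₁)
  A ⊇ˢ A' = toList A' ⊆ toList A

  _,,_ : FinSub → FinSub → FinSub
  A ,, B = A ⁺++⁺ B

  _+ˢ_ : FinSub → Carrier → FinSub
  A +ˢ y = L⁺.map (λ a → a ∙ y) A

  _·_ : ℕ → Carrier → Carrier
  zero  · x = ε
  suc p · x = x ∙ (p · x)

  EntRel : (ℓ : Level) → Set (c ⊔ Level.suc ℓ)
  EntRel ℓ = FinSub → FinSub → Set ℓ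

  record IsRegularEntailment {ℓ} (_⊢_ : EntRel ℓ) : Set (c ⊔ ℓ₁ ⊔ ℓ₂ ⊔ ℓ) where
    field
      R1 : ∀ {A B A' B'} → A ⊇ˢ A' → B ⊇ˢ B' → A' ⊢ B' → A ⊢ B
      R2 : ∀ {A B} y → (A ,, [ y ]) ⊢ B → A ⊢ (B ,, [ y ]) → A ⊢ B
      R3 : ∀ {a b} → a ≤ b → [ a ] ⊢ [ b ]
      R4 : ∀ {A B} y → (A +ˢ y) ⊢ (B +ˢ y) → A ⊢ B
      R5 : ∀ a b u v → ([ a ∙ u ] ,, [ b ∙ v ]) ⊢ ([ a ∙ b ] ,, [ u ∙ v ])

  _Contains_ : ∀ {ℓ ℓ'} → EntRel ℓ → EntRel ℓ' → Set (c ⊔ ℓ ⊔ ℓ')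
  _⊩_ Contains _⊢_ = ∀ A B → A ⊢ B → A ⊩ B

  _at_ : ∀ {ℓ} → EntRel ℓ → Carrier → EntRel ℓ
  (_⊢_ at x) A B = Σ ℕ λ p → (A ,, (A +ˢ (p · x))) ⊢ B

module Submission where

-- The key fact is convexity: a, a + n x ⊢ a + j x for every j ≤ n, by induction from the
-- R5-instance a, a + (n+1) x ⊢ a + x, a + n x.  For the cut rule R2 with witnesses p and q one takes
-- p + q: by convexity A, A + (p+q) x may be enlarged by A + p x and A + q x, and there the two
-- hypotheses combine by cutting y and y + p x.  Minimality: in a regular ⊩ with ε ⊩ x, translation
-- and cut give a ⊩ a + p x, and cutting these out of A, A + p x ⊩ B leaves A ⊩ B.

open import Defs
open import Data.Product using (_×_; _,_; ∃)
open import Data.Sum using (inj₁; inj₂)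
open import Data.List using (List; []; _∷_; _++_)
open import Data.List.Properties using (++-assoc; ++-identityʳ; map-++)
open import Data.List.NonEmpty using ([_]; toList)
open import Data.List.Relation.Unary.Any using (here; there)
open import Data.Nat using (ℕ; zero; suc; z≤n; s≤s)
import Data.Nat as ℕ
open import Data.Nat.Properties using (m≤m+n; m≤n+m)
import Relation.Binary.PropositionalEquality as ≡
open import Relation.Binary.Structures using (IsPreorder)
import Algebra.Properties.CommutativeSemigroup as CommutativeSemigroupProperties
import Data.List.Membership.Setoid as SetoidMembership
import Data.List.Membership.Setoid.Properties as Membershipₚ
import Data.List.Relation.Binary.Subset.Setoid as SetoidSubset
import Data.List.Relation.Binary.Subset.Setoid.Properties as Subsetₚ

module _ {c ℓ₁ ℓ₂} (P : PreorderedAbelianGroup c ℓ₁ ℓ₂) where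
  open PreorderedAbelianGroup P
  open Entailment P
  open CommutativeSemigroupProperties commutativeSemigroup using (x∙yz≈y∙xz; xy∙z≈x∙zy; xy∙z≈xz∙y)
  open SetoidMembership setoid using (_∈_)
  open SetoidSubset setoid using (_⊆_)

  ∈-,,ˡ : ∀ {z} A B → z ∈ toList A → z ∈ toList (A ,, B)
  ∈-,,ˡ A B = Membershipₚ.∈-++⁺ˡ setoid

  ∈-,,ʳ : ∀ {z} A B → z ∈ toList B → z ∈ toList (A ,, B)
  ∈-,,ʳ A B = Membershipₚ.∈-++⁺ʳ setoid (toList A)

  ∈-+ˢ⁺ : ∀ {a} A u → a ∈ toList A → (a ∙ u) ∈ toList (A +ˢ u)
  ∈-+ˢ⁺ A u = Membershipₚ.∈-map⁺ setoid setoid ∙-congʳ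

  ∈-+ˢ⁻ : ∀ {z} A u → z ∈ toList (A +ˢ u) → ∃ λ a → a ∈ toList A × z ≈ a ∙ u
  ∈-+ˢ⁻ A u = Membershipₚ.∈-map⁻ setoid setoid

  ∈-[]⁻ : ∀ {z a} → z ∈ toList [ a ] → z ≈ a
  ∈-[]⁻ (here z≈a) = z≈a

  ∈-resp : ∀ {z w xs} → z ≈ w → z ∈ xs → w ∈ xs
  ∈-resp = Membershipₚ.∈-resp-≈ setoid

  ⊇-[] : ∀ {X z} → z ∈ toList X → X ⊇ˢ [ z ]
  ⊇-[] z∈X w∈[z] = ∈-resp (sym (∈-[]⁻ w∈[z])) z∈X

  ⊇-refl : ∀ {A} → A ⊇ˢ A
  ⊇-refl = Subsetₚ.⊆-refl setoid

  ⊇-trans : ∀ {A B C} → A ⊇ˢ B → B ⊇ˢ C → A ⊇ˢ C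
  ⊇-trans A⊇B B⊇C = Subsetₚ.⊆-trans setoid B⊇C A⊇B

  ⊇-,,ˡ : ∀ A B → (A ,, B) ⊇ˢ A
  ⊇-,,ˡ A B = Subsetₚ.xs⊆xs++ys setoid (toList A) (toList B)

  ⊇-,,ʳ : ∀ A B → (A ,, B) ⊇ˢ B
  ⊇-,,ʳ A B = Subsetₚ.xs⊆ys++xs setoid (toList B) (toList A)

  ⊇-,, : ∀ {X} A B → X ⊇ˢ A → X ⊇ˢ B → X ⊇ˢ (A ,, B)
  ⊇-,, A B X⊇A X⊇B z∈A,,B with Membershipₚ.∈-++⁻ setoid (toList A) z∈A,,B
  ... | inj₁ z∈A = X⊇A z∈A
  ... | inj₂ z∈B = X⊇B z∈B

  +ˢ-⊆ : ∀ {xs} A u → (∀ {a} → a ∈ toList A → (a ∙ u) ∈ xs) → toList (A +ˢ u) ⊆ xs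
  +ˢ-⊆ A u A+u⊆xs z∈A+u with ∈-+ˢ⁻ A u z∈A+u
  ... | a , a∈A , z≈a∙u = ∈-resp (sym z≈a∙u) (A+u⊆xs a∈A)

  +ˢ-+ˢ-⊆ : ∀ {xs} A u v → (∀ {a} → a ∈ toList A → ((a ∙ u) ∙ v) ∈ xs) →
            toList ((A +ˢ u) +ˢ v) ⊆ xs
  +ˢ-+ˢ-⊆ {xs} A u v A+u+v⊆xs = +ˢ-⊆ (A +ˢ u) v a'∙v∈xs
    where
    a'∙v∈xs : ∀ {a'} → a' ∈ toList (A +ˢ u) → (a' ∙ v) ∈ xs
    a'∙v∈xs a'∈A+u with ∈-+ˢ⁻ A u a'∈A+u
    ... | a , a∈A , a'≈a∙u = ∈-resp (∙-congʳ (sym a'≈a∙u)) (A+u+v⊆xs a∈A)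

  ⊇-,,-+ˢ : ∀ {X} A B u → X ⊇ˢ (A +ˢ u) → X ⊇ˢ (B +ˢ u) → X ⊇ˢ ((A ,, B) +ˢ u)
  ⊇-,,-+ˢ {X} A B u X⊇A+u X⊇B+u =
    ≡.subst (_⊆ toList X) (≡.sym (map-++ (_∙ u) (toList A) (toList B)))
            (⊇-,, (A +ˢ u) (B +ˢ u) X⊇A+u X⊇B+u)

  +ˢ-mono : ∀ {A B} u → A ⊇ˢ B → (A +ˢ u) ⊇ˢ (B +ˢ u)
  +ˢ-mono {A} {B} u A⊇B = +ˢ-⊆ B u (λ a∈B → ∈-+ˢ⁺ A u (A⊇B a∈B))

  +ˢ-cancel : ∀ A y → ((A +ˢ y) +ˢ (y ⁻¹)) ⊇ˢ A
  +ˢ-cancel A y {a} a∈A =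
    ∈-resp a∙y∙y⁻¹≈a (∈-+ˢ⁺ (A +ˢ y) (y ⁻¹) (∈-+ˢ⁺ A y a∈A))
    where
    a∙y∙y⁻¹≈a : (a ∙ y) ∙ (y ⁻¹) ≈ a
    a∙y∙y⁻¹≈a = trans (assoc a y (y ⁻¹)) (trans (∙-congˡ (inverseʳ y)) (identityʳ a))

  ·-homo-+ : ∀ m n z → ((m ℕ.+ n) · z) ≈ ((m · z) ∙ (n · z))
  ·-homo-+ zero    n z = sym (identityˡ (n · z))
  ·-homo-+ (suc m) n z = trans (∙-congˡ (·-homo-+ m n z)) (sym (assoc z (m · z) (n · z)))

  module RegularEntailmentProperties {ℓ} {_⊢_ : EntRel ℓ} (R : IsRegularEntailment _⊢_) where
    open IsRegularEntailment R

    axiom : ∀ {A B z} → z ∈ toList A → z ∈ toList B → A ⊢ B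
    axiom z∈A z∈B = R1 (⊇-[] z∈A) (⊇-[] z∈B) (R3 (IsPreorder.refl isPreorder))

    shift : ∀ {A B} y → A ⊢ B → (A +ˢ y) ⊢ (B +ˢ y)
    shift {A} {B} y A⊢B = R4 (y ⁻¹) (R1 (+ˢ-cancel A y) (+ˢ-cancel B y) A⊢B)

    cutᴸ : ∀ {Γ Γ' Δ} (E : List Carrier) → Γ' ⊢ Δ → toList Γ' ⊆ toList Γ ++ E →
           (∀ {e} → e ∈ E → Γ ⊢ (Δ ,, [ e ])) → Γ ⊢ Δ
    cutᴸ {Γ} {Γ'} [] Γ'⊢Δ Γ'⊆Γ _ =
      R1 (≡.subst (toList Γ' ⊆_) (++-identityʳ (toList Γ)) Γ'⊆Γ) ⊇-refl Γ'⊢Δ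
    cutᴸ {Γ} {Γ'} (e ∷ E) Γ'⊢Δ Γ'⊆Γ,e,E Γ⊢Δ,e =
      R2 e (cutᴸ E Γ'⊢Δ Γ'⊆Γ,e++E (λ e'∈E → R1 (⊇-,,ˡ Γ [ e ]) ⊇-refl (Γ⊢Δ,e (there e'∈E))))
           (Γ⊢Δ,e (here refl))
      where
      Γ'⊆Γ,e++E : toList Γ' ⊆ toList (Γ ,, [ e ]) ++ E
      Γ'⊆Γ,e++E = ≡.subst (toList Γ' ⊆_) (≡.sym (++-assoc (toList Γ) (e ∷ []) E)) Γ'⊆Γ,e,E

    cutᴿ : ∀ {Γ Δ Δ'} (E : List Carrier) → Γ ⊢ Δ' → toList Δ' ⊆ toList Δ ++ E →
           (∀ {e} → e ∈ E → (Γ ,, [ e ]) ⊢ Δ) → Γ ⊢ Δ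
    cutᴿ {Δ = Δ} {Δ'} [] Γ⊢Δ' Δ'⊆Δ _ =
      R1 ⊇-refl (≡.subst (toList Δ' ⊆_) (++-identityʳ (toList Δ)) Δ'⊆Δ) Γ⊢Δ'
    cutᴿ {Δ = Δ} {Δ'} (e ∷ E) Γ⊢Δ' Δ'⊆Δ,e,E Γ,e⊢Δ =
      R2 e (Γ,e⊢Δ (here refl))
           (cutᴿ E Γ⊢Δ' Δ'⊆Δ,e++E (λ e'∈E → R1 ⊇-refl (⊇-,,ˡ Δ [ e ]) (Γ,e⊢Δ (there e'∈E))))
      where
      Δ'⊆Δ,e++E : toList Δ' ⊆ toList (Δ ,, [ e ]) ++ E
      Δ'⊆Δ,e++E = ≡.subst (toList Δ' ⊆_) (≡.sym (++-assoc (toList Δ) (e ∷ []) E)) Δ'⊆Δ,e,E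

    between-first : ∀ x n a → ([ a ] ,, [ a ∙ (suc n · x) ]) ⊢ [ a ∙ x ]
    between-first x zero    a =
      axiom {z = a ∙ x} (there (here (∙-congˡ (sym (identityʳ x))))) (here refl)
    between-first x (suc n) a =
      R2 w (R1 (⊇-,, [ a ] [ w ] (⊇-[] (here refl)) (⊇-[] (there (there (here refl))))) ⊇-refl
               (between-first x n a))
           (R1 (⊇-,, [ a ∙ ε ] [ x ∙ w ] (⊇-[] (here (identityʳ a)))
                                         (⊇-[] (there (here (x∙yz≈y∙xz x a (suc n · x))))))
               (⊇-,, [ a ∙ x ] [ ε ∙ w ] (⊇-[] (here refl)) (⊇-[] (there (here (identityˡ w)))))
               (R5 a x ε w))
      where
      w : Carrier
      w = a ∙ (suc n · x)

    between : ∀ x {j n} → j ℕ.≤ n → ∀ a → ([ a ] ,, [ a ∙ (n · x) ]) ⊢ [ a ∙ (j · x) ]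
    between x z≤n a = axiom {z = a ∙ ε} (here (identityʳ a)) (here refl)
    between x (s≤s {j} {n} j≤n) a =
      R2 (a ∙ x)
        (R1 (⊇-,, [ a ∙ x ] [ (a ∙ x) ∙ (n · x) ] (⊇-[] (there (there (here refl))))
                                                  (⊇-[] (there (here (assoc a x (n · x))))))
            (⊇-[] (here (assoc a x (j · x))))
            (between x j≤n (a ∙ x)))
        (R1 ⊇-refl (⊇-,,ʳ [ a ∙ (suc j · x) ] [ a ∙ x ]) (between-first x n a))

    -- each b + u on the right is traded for b using the R5-instance b + u, c ⊢ b, c + u
    transfer : ∀ {Γ Δ} c u → Γ ⊢ ((Δ ,, [ c ]) +ˢ u) → (Γ ,, [ c ]) ⊢ (Δ ,, [ c ∙ u ])
    transfer {Γ} {Δ} c u Γ⊢Δ+u,c+u =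
      cutᴿ (toList (Δ +ˢ u)) (R1 (⊇-,,ˡ Γ [ c ]) ⊇-refl Γ⊢Δ+u,c+u)
           (+ˢ-⊆ (Δ ,, [ c ]) u cover) cut-b+u
      where
      cover : ∀ {a} → a ∈ toList (Δ ,, [ c ]) → (a ∙ u) ∈ toList (Δ ,, [ c ∙ u ]) ++ toList (Δ +ˢ u)
      cover a∈Δ,c with Membershipₚ.∈-++⁻ setoid (toList Δ) a∈Δ,c
      ... | inj₁ a∈Δ = Membershipₚ.∈-++⁺ʳ setoid (toList (Δ ,, [ c ∙ u ])) (∈-+ˢ⁺ Δ u a∈Δ)
      ... | inj₂ a∈c = Membershipₚ.∈-++⁺ˡ setoid (∈-,,ʳ Δ [ c ∙ u ] (here (∙-congʳ (∈-[]⁻ a∈c))))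
      cut-b+u : ∀ {e} → e ∈ toList (Δ +ˢ u) → ((Γ ,, [ c ]) ,, [ e ]) ⊢ (Δ ,, [ c ∙ u ])
      cut-b+u {e} e∈Δ+u with ∈-+ˢ⁻ Δ u e∈Δ+u
      ... | b , b∈Δ , e≈b∙u =
        R1 (⊇-,, [ b ∙ u ] [ ε ∙ c ] (⊇-[] (∈-,,ʳ (Γ ,, [ c ]) [ e ] (here (sym e≈b∙u))))
                                     (⊇-[] (∈-,,ˡ (Γ ,, [ c ]) [ e ] (∈-,,ʳ Γ [ c ] (here (identityˡ c))))))
           (⊇-,, [ b ∙ ε ] [ u ∙ c ] (⊇-[] (∈-,,ˡ Δ [ c ∙ u ] (∈-resp (sym (identityʳ b)) b∈Δ)))
                                     (⊇-[] (∈-,,ʳ Δ [ c ∙ u ] (here (comm u c)))))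
           (R5 b ε u c)

    ε⊢x⇒a⊢a∙p·x : ∀ {x} → [ ε ] ⊢ [ x ] → ∀ p a → [ a ] ⊢ [ a ∙ (p · x) ]
    ε⊢x⇒a⊢a∙p·x         ε⊢x zero    a = axiom {z = a} (here refl) (here (sym (identityʳ a)))
    ε⊢x⇒a⊢a∙p·x {x} ε⊢x (suc p) a =
      R2 (a ∙ x)
        (R1 (⊇-[] (∈-,,ʳ [ a ] [ a ∙ x ] (here refl))) (⊇-[] (here (assoc a x (p · x))))
            (ε⊢x⇒a⊢a∙p·x ε⊢x p (a ∙ x)))
        (R1 (⊇-[] (here (identityˡ a))) (⊇-[] (there (here (comm x a)))) (shift a ε⊢x))

  module AtProperties {ℓ} {_⊢_ : EntRel ℓ} (R : IsRegularEntailment _⊢_) (x : Carrier) where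
    open IsRegularEntailment R
    open RegularEntailmentProperties R

    at-contains : (_⊢_ at x) Contains _⊢_
    at-contains A B A⊢B = 0 , R1 (⊇-,,ˡ A (A +ˢ ε)) ⊇-refl A⊢B

    at-ε⊢x : (_⊢_ at x) [ ε ] [ x ]
    at-ε⊢x = 1 , axiom {z = x} (there (here (sym (trans (identityˡ _) (identityʳ x))))) (here refl)

    at-R1 : ∀ {A B A' B'} → A ⊇ˢ A' → B ⊇ˢ B' → (_⊢_ at x) A' B' → (_⊢_ at x) A B
    at-R1 {A} {A' = A'} A⊇A' B⊇B' (p , A',A'+px⊢B') =
      p , R1 (⊇-,, A' (A' +ˢ (p · x)) (⊇-trans (⊇-,,ˡ A _) A⊇A')
                                      (⊇-trans (⊇-,,ʳ A _) (+ˢ-mono (p · x) A⊇A')))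
             B⊇B' A',A'+px⊢B'

    at-R4 : ∀ {A B} y → (_⊢_ at x) (A +ˢ y) (B +ˢ y) → (_⊢_ at x) A B
    at-R4 {A} y (p , A+y,A+y+px⊢B+y) =
      p , R4 y (R1 (⊇-,, (A +ˢ y) ((A +ˢ y) +ˢ px) (+ˢ-mono y (⊇-,,ˡ A (A +ˢ px)))
                                                   (+ˢ-+ˢ-⊆ A y px a∙y∙px∈))
                   ⊇-refl A+y,A+y+px⊢B+y)
      where
      px : Carrier
      px = p · x
      a∙y∙px∈ : ∀ {a} → a ∈ toList A → ((a ∙ y) ∙ px) ∈ toList ((A ,, (A +ˢ px)) +ˢ y)
      a∙y∙px∈ a∈A = ∈-resp (sym (xy∙z≈xz∙y _ y px))
                            (∈-+ˢ⁺ (A ,, (A +ˢ px)) y (∈-,,ʳ A (A +ˢ px) (∈-+ˢ⁺ A px a∈A)))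

    module _ {A : FinSub} (p q : ℕ) where
      private
        px qx rx : Carrier
        px = p · x
        qx = q · x
        rx = (p ℕ.+ q) · x
        Γ Γ⁺ : FinSub
        Γ  = A ,, (A +ˢ rx)
        Γ⁺ = Γ ,, ((A +ˢ px) ,, (A +ˢ qx))

      at-R2-widened : ∀ {B} y → ((A ,, [ y ]) ,, ((A ,, [ y ]) +ˢ px)) ⊢ B →
                      (A ,, (A +ˢ qx)) ⊢ (B ,, [ y ]) → Γ⁺ ⊢ B
      at-R2-widened {B} y A,y,A+px,y+px⊢B A,A+qx⊢B,y =
        R2 y (R2 (y ∙ px) Γ⁺,y,y+px⊢B Γ⁺,y⊢B,y+px)
             (R1 (⊇-,, A (A +ˢ qx) Γ⁺⊇A Γ⁺⊇A+qx) ⊇-refl A,A+qx⊢B,y)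
        where
        Γ⁺⊇A : Γ⁺ ⊇ˢ A
        Γ⁺⊇A = ⊇-trans (⊇-,,ˡ Γ _) (⊇-,,ˡ A (A +ˢ rx))
        Γ⁺⊇A+px : Γ⁺ ⊇ˢ (A +ˢ px)
        Γ⁺⊇A+px = ⊇-trans (⊇-,,ʳ Γ _) (⊇-,,ˡ (A +ˢ px) (A +ˢ qx))
        Γ⁺⊇A+qx : Γ⁺ ⊇ˢ (A +ˢ qx)
        Γ⁺⊇A+qx = ⊇-trans (⊇-,,ʳ Γ _) (⊇-,,ʳ (A +ˢ px) (A +ˢ qx))
        Γ⁺⊇A+qx+px : Γ⁺ ⊇ˢ ((A +ˢ qx) +ˢ px)
        Γ⁺⊇A+qx+px = +ˢ-+ˢ-⊆ A qx px λ a∈A →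
          ∈-resp (sym (trans (xy∙z≈x∙zy _ qx px) (∙-congˡ (sym (·-homo-+ p q x)))))
                 (⊇-,,ˡ Γ _ (∈-,,ʳ A (A +ˢ rx) (∈-+ˢ⁺ A rx a∈A)))
        Γ⁺,y⊢B,y+px : (Γ⁺ ,, [ y ]) ⊢ (B ,, [ y ∙ px ])
        Γ⁺,y⊢B,y+px = transfer y px (R1 (⊇-,,-+ˢ A (A +ˢ qx) px Γ⁺⊇A+px Γ⁺⊇A+qx+px) ⊇-refl
                                        (shift px A,A+qx⊢B,y))
        Γ⁺,y,y+px⊢B : ((Γ⁺ ,, [ y ]) ,, [ y ∙ px ]) ⊢ B
        Γ⁺,y,y+px⊢B = R1 (⊇-,, (A ,, [ y ]) ((A ,, [ y ]) +ˢ px)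
                           (⊇-,, A [ y ] (⊇-trans (⊇-trans (⊇-,,ˡ _ _) (⊇-,,ˡ _ _)) Γ⁺⊇A)
                                         (⊇-[] (∈-,,ˡ _ _ (∈-,,ʳ Γ⁺ [ y ] (here refl)))))
                           (⊇-,,-+ˢ A [ y ] px (⊇-trans (⊇-trans (⊇-,,ˡ _ _) (⊇-,,ˡ _ _)) Γ⁺⊇A+px)
                                               (⊇-[] (∈-,,ʳ (Γ⁺ ,, [ y ]) [ y ∙ px ] (here refl)))))
                         ⊇-refl A,y,A+px,y+px⊢B

      Γ⊢a∙j·x : ∀ {a j} → j ℕ.≤ p ℕ.+ q → a ∈ toList A → Γ ⊢ [ a ∙ (j · x) ]
      Γ⊢a∙j·x {a} j≤r a∈A =
        R1 (⊇-,, [ a ] [ a ∙ rx ] (⊇-[] (∈-,,ˡ A (A +ˢ rx) a∈A))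
                                  (⊇-[] (∈-,,ʳ A (A +ˢ rx) (∈-+ˢ⁺ A rx a∈A))))
           ⊇-refl (between x j≤r a)

    at-R2 : ∀ {A B} y → (_⊢_ at x) (A ,, [ y ]) B → (_⊢_ at x) A (B ,, [ y ]) → (_⊢_ at x) A B
    at-R2 {A} {B} y (p , A,y,A+px,y+px⊢B) (q , A,A+qx⊢B,y) =
      p ℕ.+ q ,
      cutᴸ (toList ((A +ˢ (p · x)) ,, (A +ˢ (q · x))))
           (at-R2-widened {A} p q y A,y,A+px,y+px⊢B A,A+qx⊢B,y) (Subsetₚ.⊆-refl setoid) cut-a+jx
      where
      cut-a+jx : ∀ {e} → e ∈ toList ((A +ˢ (p · x)) ,, (A +ˢ (q · x))) →
                 (A ,, (A +ˢ ((p ℕ.+ q) · x))) ⊢ (B ,, [ e ])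
      cut-a+jx {e} e∈ with Membershipₚ.∈-++⁻ setoid (toList (A +ˢ (p · x))) e∈
      ... | inj₁ e∈A+px with ∈-+ˢ⁻ A (p · x) e∈A+px
      ...   | a , a∈A , e≈a∙px =
        R1 ⊇-refl (⊇-[] (∈-,,ʳ B [ e ] (here (sym e≈a∙px)))) (Γ⊢a∙j·x {A} p q (m≤m+n p q) a∈A)
      cut-a+jx {e} e∈ | inj₂ e∈A+qx with ∈-+ˢ⁻ A (q · x) e∈A+qx
      ...   | a , a∈A , e≈a∙qx =
        R1 ⊇-refl (⊇-[] (∈-,,ʳ B [ e ] (here (sym e≈a∙qx)))) (Γ⊢a∙j·x {A} p q (m≤n+m q p) a∈A)

    at-isRegular : IsRegularEntailment (_⊢_ at x)
    at-isRegular = record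
      { R1 = at-R1
      ; R2 = at-R2
      ; R3 = λ a≤b → at-contains _ _ (R3 a≤b)
      ; R4 = at-R4
      ; R5 = λ a b u v → at-contains _ _ (R5 a b u v)
      }

  at-least : ∀ {ℓ} {_⊢_ _⊩_ : EntRel ℓ} {x} → IsRegularEntailment _⊩_ → _⊩_ Contains _⊢_ →
          [ ε ] ⊩ [ x ] → _⊩_ Contains (_⊢_ at x)
  at-least {_⊩_ = _⊩_} {x = x} R' ⊩⊇⊢ ε⊩x A B (p , A,A+px⊢B) =
    cutᴸ (toList (A +ˢ (p · x))) (⊩⊇⊢ _ _ A,A+px⊢B) (Subsetₚ.⊆-refl setoid) A⊩B,a+px
    where
    open IsRegularEntailment R' using (R1)
    open RegularEntailmentProperties R'
    A⊩B,a+px : ∀ {e} → e ∈ toList (A +ˢ (p · x)) → A ⊩ (B ,, [ e ])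
    A⊩B,a+px {e} e∈A+px with ∈-+ˢ⁻ A (p · x) e∈A+px
    ... | a , a∈A , e≈a∙px =
      R1 (⊇-[] a∈A) (⊇-[] (∈-,,ʳ B [ e ] (here (sym e≈a∙px)))) (ε⊢x⇒a⊢a∙p·x ε⊩x p a)

proposition1p6 : ∀ {c ℓ₁ ℓ₂ ℓ} (P : PreorderedAbelianGroup c ℓ₁ ℓ₂) →
    let open PreorderedAbelianGroup P
        open Entailment P
    in (_⊢_ : EntRel ℓ) → IsRegularEntailment _⊢_ → (x : Carrier) →
       IsRegularEntailment (_⊢_ at x)
       × (_⊢_ at x) Contains _⊢_
       × (_⊢_ at x) [ ε ] [ x ]
       × (∀ (_⊩_ : EntRel ℓ) → IsRegularEntailment _⊩_ → _⊩_ Contains _⊢_ →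
            [ ε ] ⊩ [ x ] → _⊩_ Contains (_⊢_ at x))
proposition1p6 P _⊢_ R x =
  at-isRegular , at-contains , at-ε⊢x , λ _⊩_ R' ⊩⊇⊢ ε⊩x → at-least P R' ⊩⊇⊢ ε⊩x
  where
  open AtProperties P R x
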